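{- Let $F:\mathcal V\to\mathcal W$ be any functor between small categories, and let $F^*:\widehat{\mathcal W}\to\widehat{\mathcal V}$ be the functor $\Gamma\mapsto\Gamma\circ F^{op}$ (precomposition with $F$). Then $F^*$ is (the underlying context-functor of) a strict morphism of categories with families from the presheaf CwF $\widehat{\mathcal W}$ to the presheaf CwF $\widehat{\mathcal V}$.
   Context: For a small category $\mathcal W$, the presheaf CwF $\widehat{\mathcal W}$ is given as follows. Contexts are presheaves $\Gamma:\mathcal W^{op}\to\mathbf{Set}$ (write $\gamma\cdot\varphi\in\Gamma(V)$ for the restriction of $\gamma\in\Gamma(W)$ along $\varphi:V\to W$), substitutions are natural transformations. A type $\Gamma\vdash T$ is a presheaf on the category of elements of $\Gamma$: sets $T[\gamma]$ for all $\gamma\in\Gamma(W)$ and restriction maps $T[\gamma]\to T[\gamma\cdot\varphi]$, $t\mapsto t\langle\varphi\rangle$, functorially; for $\sigma:\Delta\to\Gamma$, $T[\sigma][\delta]=T[\sigma\delta]$ with inherited restriction. A term $\Gamma\vdash t:T$ is a family $t[\gamma]\in T[\gamma]$ with $t[\gamma]\langle\varphi\rangle=t[\gamma\cdot\varphi]$, and $t[\sigma][\delta]=t[\sigma\delta]$. The empty context $()$ is the terminal presheaf; context extension is $(\Gamma.T)(W)=\{(\gamma,t):\gamma\in\Gamma(W),t\in T[\gamma]\}$ with $(\gamma,t)\cdot\varphi=(\gamma\cdot\varphi,t\langle\varphi\rangle)$, projection $\pi(\gamma,t)=\gamma$ and variable term $\xi[(\gamma,t)]=t$. A (weak) morphism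 of CwFs $F:\mathcal C\to\mathcal D$ consists of a functor $F_{Ctx}$ between the categories of contexts, a natural transformation $F_{Ty}:\mathrm{Ty}_{\mathcal C}\to\mathrm{Ty}_{\mathcal D}\circ F_{Ctx}$ (types over $\Gamma$ to types over $F\Gamma$, commuting with substitution) and a natural transformation $F_{Tm}$ sending terms $\Gamma\vdash t:T$ to terms $F\Gamma\vdash Ft:FT$ (commuting with substitution), such that $F()$ is terminal and $(F\pi,F\xi):F(\Gamma.T)\to F\Gamma.FT$ is an isomorphism. It is strict if moreover $F()=()$, $F(\Gamma.T)=F\Gamma.FT$, $F\pi=\pi$ and $F\xi=\xi$. -}

module Defs where

open import Level using (Level; _⊔_) renaming (suc to lsuc; zero to lzero)
open import Data.Unit.Polymorphic using (⊤; tt)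
open import Data.Product using (Σ; _,_; proj₁; proj₂; _×_)
open import Relation.Binary.PropositionalEquality
  using (_≡_; refl; sym; trans; cong; subst)
open import Relation.Binary.HeterogeneousEquality using (_≅_)

record Category : Set₁ where
  infixr 9 _∘_
  field
    Obj   : Set
    Hom   : Obj → Obj → Set
    id    : ∀ {A} → Hom A A
    _∘_   : ∀ {A B C} → Hom B C → Hom A B → Hom A C
    idˡ   : ∀ {A B} (f : Hom A B) → id ∘ f ≡ f
    idʳ   : ∀ {A B} (f : Hom A B) → f ∘ id ≡ f
    assoc : ∀ {A B C D} (f : Hom C D) (g : Hom B C) (h : Hom A B) →
            (f ∘ g) ∘ h ≡ f ∘ (g ∘ h)

record Functor (𝒱 𝒲 : Category) : Set where
  private
    module V = Category 𝒱
    module W = Category 𝒲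
  field
    F₀   : V.Obj → W.Obj
    F₁   : ∀ {A B} → V.Hom A B → W.Hom (F₀ A) (F₀ B)
    F-id : ∀ {A} → F₁ (V.id {A}) ≡ W.id
    F-∘  : ∀ {A B C} (f : V.Hom B C) (g : V.Hom A B) →
           F₁ (f V.∘ g) ≡ F₁ f W.∘ F₁ g

record CwF (o h t m : Level) : Set (lsuc (o ⊔ h ⊔ t ⊔ m)) where
  infixr 9 _∘S_
  infixl 5 _▷_
  field
    Ctx   : Set o
    Sub   : Ctx → Ctx → Set h
    idS   : ∀ {Γ} → Sub Γ Γ
    _∘S_  : ∀ {Γ Δ Θ} → Sub Δ Θ → Sub Γ Δ → Sub Γ Θ
    idlS  : ∀ {Γ Δ} (σ : Sub Γ Δ) → idS ∘S σ ≡ σ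
    idrS  : ∀ {Γ Δ} (σ : Sub Γ Δ) → σ ∘S idS ≡ σ
    assS  : ∀ {Γ Δ Θ Ξ} (σ : Sub Θ Ξ) (τ : Sub Δ Θ) (υ : Sub Γ Δ) →
            (σ ∘S τ) ∘S υ ≡ σ ∘S (τ ∘S υ)
    Ty    : Ctx → Set t
    _[_]T : ∀ {Γ Δ} → Ty Γ → Sub Δ Γ → Ty Δ
    [id]T : ∀ {Γ} (T : Ty Γ) → T [ idS ]T ≡ T
    [∘]T  : ∀ {Γ Δ Θ} (T : Ty Θ) (σ : Sub Δ Θ) (τ : Sub Γ Δ) →
            T [ σ ∘S τ ]T ≡ (T [ σ ]T) [ τ ]T
    Tm    : (Γ : Ctx) → Ty Γ → Set m
    _[_]t : ∀ {Γ Δ} {T : Ty Γ} → Tm Γ T → (σ : Sub Δ Γ) → Tm Δ (T [ σ ]T)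
    [id]t : ∀ {Γ} {T : Ty Γ} (a : Tm Γ T) → subst (Tm Γ) ([id]T T) (a [ idS ]t) ≡ a
    [∘]t  : ∀ {Γ Δ Θ} {T : Ty Θ} (a : Tm Θ T) (σ : Sub Δ Θ) (τ : Sub Γ Δ) →
            subst (Tm Γ) ([∘]T T σ τ) (a [ σ ∘S τ ]t) ≡ (a [ σ ]t) [ τ ]t
    ◇     : Ctx
    ε     : ∀ {Γ} → Sub Γ ◇
    ε-η   : ∀ {Γ} (σ : Sub Γ ◇) → σ ≡ ε
    _▷_   : (Γ : Ctx) → Ty Γ → Ctx
    p     : ∀ {Γ} {T : Ty Γ} → Sub (Γ ▷ T) Γ
    q     : ∀ {Γ} {T : Ty Γ} → Tm (Γ ▷ T) (T [ p ]T)
    ⟨_,_⟩ : ∀ {Γ Δ} {T : Ty Γ} (σ : Sub Δ Γ) → Tm Δ (T [ σ ]T) → Sub Δ (Γ ▷ T)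
    p∘⟨⟩  : ∀ {Γ Δ} {T : Ty Γ} (σ : Sub Δ Γ) (a : Tm Δ (T [ σ ]T)) →
            p ∘S ⟨ σ , a ⟩ ≡ σ
    q[⟨⟩] : ∀ {Γ Δ} {T : Ty Γ} (σ : Sub Δ Γ) (a : Tm Δ (T [ σ ]T)) →
            subst (Tm Δ) (trans (sym ([∘]T T p ⟨ σ , a ⟩)) (cong (T [_]T) (p∘⟨⟩ σ a)))
                  (q [ ⟨ σ , a ⟩ ]t) ≡ a
    ⟨⟩-η  : ∀ {Γ Δ} {T : Ty Γ} (τ : Sub Δ (Γ ▷ T)) →
            ⟨ p ∘S τ , subst (Tm Δ) (sym ([∘]T T p τ)) (q [ τ ]t) ⟩ ≡ τ

module _ {o h t m} (C : CwF o h t m) where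
  open CwF C

  IsTerminal : Ctx → Set (o ⊔ h)
  IsTerminal X = ∀ Y → Σ (Sub Y X) (λ σ → ∀ τ → τ ≡ σ)

  IsIso : ∀ {Γ Δ} → Sub Γ Δ → Set h
  IsIso {Γ} {Δ} f = Σ (Sub Δ Γ) (λ g → (g ∘S f ≡ idS) × (f ∘S g ≡ idS))

module _ {o h t m o' h' t' m'} (C : CwF o h t m) (D : CwF o' h' t' m') where
  private
    module C = CwF C
    module D = CwF D

  record IsCwFMorphism (F₀ : C.Ctx → D.Ctx)
                       (F₁ : ∀ {Γ Δ} → C.Sub Γ Δ → D.Sub (F₀ Γ) (F₀ Δ))
         : Set (o ⊔ h ⊔ t ⊔ m ⊔ o' ⊔ h' ⊔ t' ⊔ m') where
    field
      F-id    : ∀ {Γ} → F₁ (C.idS {Γ}) ≡ D.idS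
      F-∘     : ∀ {Γ Δ Θ} (σ : C.Sub Δ Θ) (τ : C.Sub Γ Δ) →
                F₁ (σ C.∘S τ) ≡ F₁ σ D.∘S F₁ τ
      FTy     : ∀ {Γ} → C.Ty Γ → D.Ty (F₀ Γ)
      FTy-nat : ∀ {Γ Δ} (T : C.Ty Γ) (σ : C.Sub Δ Γ) →
                FTy (T C.[ σ ]T) ≡ (FTy T) D.[ F₁ σ ]T
      FTm     : ∀ {Γ} {T : C.Ty Γ} → C.Tm Γ T → D.Tm (F₀ Γ) (FTy T)
      FTm-nat : ∀ {Γ Δ} {T : C.Ty Γ} (a : C.Tm Γ T) (σ : C.Sub Δ Γ) →
                subst (D.Tm (F₀ Δ)) (FTy-nat T σ) (FTm (a C.[ σ ]t))
                  ≡ (FTm a) D.[ F₁ σ ]t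
      F◇-terminal : IsTerminal D (F₀ C.◇)
      -- (Fπ , Fξ) : F(Γ.T) → FΓ.FT is an isomorphism
      F▷-iso  : ∀ {Γ} (T : C.Ty Γ) →
                IsIso D (D.⟨_,_⟩ {T = FTy T} (F₁ (C.p {Γ} {T}))
                          (subst (D.Tm (F₀ (Γ C.▷ T))) (FTy-nat T C.p) (FTm (C.q {Γ} {T}))))

  record IsStrictCwFMorphism (F₀ : C.Ctx → D.Ctx)
                             (F₁ : ∀ {Γ Δ} → C.Sub Γ Δ → D.Sub (F₀ Γ) (F₀ Δ))
         : Set (o ⊔ h ⊔ t ⊔ m ⊔ o' ⊔ h' ⊔ t' ⊔ m') where
    field
      isMorphism : IsCwFMorphism F₀ F₁
    open IsCwFMorphism isMorphism public
    field
      F◇ : F₀ C.◇ ≡ D.◇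
      F▷ : ∀ {Γ} (T : C.Ty Γ) → F₀ (Γ C.▷ T) ≡ (F₀ Γ D.▷ FTy T)
      Fp : ∀ {Γ} (T : C.Ty Γ) → F₁ (C.p {Γ} {T}) ≅ D.p {F₀ Γ} {FTy T}
      Fq : ∀ {Γ} (T : C.Ty Γ) → FTm (C.q {Γ} {T}) ≅ D.q {F₀ Γ} {FTy T}

-- Presheaves, with proof fields irrelevant (so that presheaves and
-- natural transformations are equal as soon as their data are).

module Presheaves (𝒲 : Category) where
  open Category 𝒲

  record Psh : Set₁ where
    field
      obj      : Obj → Set
      restr    : ∀ {W V} → obj W → Hom V W → obj V
      .restr-id : ∀ {W} (γ : obj W) → restr γ id ≡ γ
      .restr-∘  : ∀ {W V U} (γ : obj W) (φ : Hom V W) (ψ : Hom U V) →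
                  restr γ (φ ∘ ψ) ≡ restr (restr γ φ) ψ
  open Psh public

  record NatTr (Δ Γ : Psh) : Set where
    field
      fun  : ∀ {W} → obj Δ W → obj Γ W
      .nat : ∀ {W V} (δ : obj Δ W) (φ : Hom V W) →
             fun (restr Δ δ φ) ≡ restr Γ (fun δ) φ
  open NatTr public

  -- Types: presheaves on the category of elements of Γ.  The restriction
  -- T[γ] → T[γ·φ] is presented as a map T[γ] → T[γ'] for any γ' given
  -- with an (irrelevant) proof of γ·φ ≡ γ'.
  record PTy (Γ : Psh) : Set₁ where
    field
      tobj   : ∀ {W} → obj Γ W → Set
      trestr : ∀ {W V} {γ : obj Γ W} {γ' : obj Γ V} (φ : Hom V W) →
               .(restr Γ γ φ ≡ γ') → tobj γ → tobj γ'
      .trestr-id : ∀ {W} {γ : obj Γ W} .(e : restr Γ γ id ≡ γ) (a : tobj γ) →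
                   trestr id e a ≡ a
      .trestr-∘  : ∀ {W V U} {γ : obj Γ W} {γ₁ : obj Γ V} {γ₂ : obj Γ U}
                   (φ : Hom V W) (ψ : Hom U V)
                   .(e₁ : restr Γ γ φ ≡ γ₁) .(e₂ : restr Γ γ₁ ψ ≡ γ₂)
                   .(e : restr Γ γ (φ ∘ ψ) ≡ γ₂) (a : tobj γ) →
                   trestr (φ ∘ ψ) e a ≡ trestr ψ e₂ (trestr φ e₁ a)
  open PTy public

  record PTm (Γ : Psh) (T : PTy Γ) : Set where
    field
      tm   : ∀ {W} (γ : obj Γ W) → tobj T γ
      .tnat : ∀ {W V} (γ : obj Γ W) (φ : Hom V W) →
              trestr T φ refl (tm γ) ≡ tm (restr Γ γ φ)
  open PTm public

  private
    Σ-path : ∀ {A : Set} {B : A → Set} {x x' : A} {b : B x} {b' : B x'}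
             (e : x ≡ x') → subst B e b ≡ b' → (x , b) ≡ (x' , b')
    Σ-path refl refl = refl

    subst-trestr : ∀ {Γ : Psh} (T : PTy Γ) {W V} {γ : obj Γ W} {γ₁ γ₂ : obj Γ V}
                   (φ : Hom V W) .(e : restr Γ γ φ ≡ γ₁) (e' : γ₁ ≡ γ₂) (a : tobj T γ) →
                   subst (tobj T) e' (trestr T φ e a) ≡ trestr T φ (trans e e') a
    subst-trestr T φ e refl a = refl

    subst-dep : ∀ {A : Set} {P : A → Set} (f : (x : A) → P x) {x y : A} (e : x ≡ y) →
                subst P e (f x) ≡ f y
    subst-dep f refl = refl

  idN : ∀ {Γ} → NatTr Γ Γ
  idN = record { fun = λ γ → γ ; nat = λ _ _ → refl }

  _∘N_ : ∀ {Γ Δ Θ} → NatTr Δ Θ → NatTr Γ Δ → NatTr Γ Θ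
  σ@record { nat = nσ } ∘N τ@record { nat = nτ } =
    record { fun = λ γ → fun σ (fun τ γ)
           ; nat = λ γ φ → trans (cong (fun σ) (nτ γ φ)) (nσ (fun τ γ) φ) }

  _[_]PT : ∀ {Γ Δ} → PTy Γ → NatTr Δ Γ → PTy Δ
  T@record { trestr-id = tid ; trestr-∘ = tc } [ σ@record { nat = nσ } ]PT = record
    { tobj = λ δ → tobj T (fun σ δ)
    ; trestr = λ {_} {_} {δ} φ e a → trestr T φ (trans (sym (nσ δ φ)) (cong (fun σ) e)) a
    ; trestr-id = λ e a → tid _ a
    ; trestr-∘ = λ φ ψ e₁ e₂ e a → tc φ ψ _ _ _ a
    }

  _[_]Pt : ∀ {Γ Δ} {T : PTy Γ} → PTm Γ T → (σ : NatTr Δ Γ) → PTm Δ (T [ σ ]PT)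
  _[_]Pt {Γ} {Δ} {T} a@record { tnat = ta } σ@record { nat = nσ } = record
    { tm = λ δ → tm a (fun σ δ)
    ; tnat = λ δ φ →
        trans (trans (sym (subst-trestr T φ refl (trans (sym (nσ δ φ)) refl) (tm a (fun σ δ))))
                     (cong (subst (tobj T) (trans (sym (nσ δ φ)) refl)) (ta (fun σ δ) φ)))
              (subst-dep (tm a) (trans (sym (nσ δ φ)) refl))
    }

  ◇P : Psh
  ◇P = record { obj = λ _ → ⊤ ; restr = λ _ _ → tt ; restr-id = λ _ → refl ; restr-∘ = λ _ _ _ → refl }

  _▷P_ : (Γ : Psh) → PTy Γ → Psh
  Γ@record { restr-id = rid ; restr-∘ = rc } ▷P T@record { trestr-id = tid ; trestr-∘ = tc } = record
    { obj = λ W → Σ (obj Γ W) (tobj T)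
    ; restr = λ (γ , a) φ → (restr Γ γ φ , trestr T φ refl a)
    ; restr-id = λ (γ , a) →
        Σ-path (rid γ)
               (trans (subst-trestr T id refl (rid γ) a) (tid _ a))
    ; restr-∘ = λ (γ , a) φ ψ →
        Σ-path (rc γ φ ψ)
               (trans (subst-trestr T (φ ∘ ψ) refl (rc γ φ ψ) a)
                      (tc φ ψ refl refl _ a))
    }

  pP : ∀ {Γ} {T : PTy Γ} → NatTr (Γ ▷P T) Γ
  pP = record { fun = proj₁ ; nat = λ _ _ → refl }

  qP : ∀ {Γ} {T : PTy Γ} → PTm (Γ ▷P T) (T [ pP {Γ} {T} ]PT)
  qP = record { tm = proj₂ ; tnat = λ _ _ → refl }

  ⟨_,_⟩P : ∀ {Γ Δ} {T : PTy Γ} (σ : NatTr Δ Γ) → PTm Δ (T [ σ ]PT) → NatTr Δ (Γ ▷P T)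
  ⟨_,_⟩P {Γ} {Δ} {T} σ@record { nat = nσ } a@record { tnat = ta } = record
    { fun = λ δ → (fun σ δ , tm a δ)
    ; nat = λ δ φ →
        Σ-path (nσ δ φ)
          (trans (cong (subst (tobj T) (nσ δ φ)) (sym (ta δ φ)))
                 (subst-trestr T φ _ (nσ δ φ) (tm a δ)))
    }

PshCwF : Category → CwF (lsuc lzero) lzero (lsuc lzero) lzero
PshCwF 𝒲 = record
  { Ctx = Psh ; Sub = λ Δ Γ → NatTr Δ Γ ; idS = idN ; _∘S_ = _∘N_
  ; idlS = λ _ → refl ; idrS = λ _ → refl ; assS = λ _ _ _ → refl
  ; Ty = PTy ; _[_]T = _[_]PT ; [id]T = λ _ → refl ; [∘]T = λ _ _ _ → refl
  ; Tm = PTm ; _[_]t = _[_]Pt ; [id]t = λ _ → refl ; [∘]t = λ _ _ _ → refl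
  ; ◇ = ◇P ; ε = record { fun = λ _ → tt ; nat = λ _ _ → refl } ; ε-η = λ _ → refl
  ; _▷_ = _▷P_ ; p = λ {Γ} {T} → pP {Γ} {T} ; q = λ {Γ} {T} → qP {Γ} {T}
  ; ⟨_,_⟩ = λ {Γ} {Δ} {T} → ⟨_,_⟩P {Γ} {Δ} {T}
  ; p∘⟨⟩ = λ {Γ} {Δ} {T} _ _ → refl ; q[⟨⟩] = λ {Γ} {Δ} {T} _ _ → refl
  ; ⟨⟩-η = λ {Γ} {Δ} {T} _ → refl
  }
  where open Presheaves 𝒲

module _ {𝒱 𝒲 : Category} (F : Functor 𝒱 𝒲) where
  private
    module V = Category 𝒱
    module PV = Presheaves 𝒱
    module PW = Presheaves 𝒲
  open Functor F

  F*₀ : PW.Psh → PV.Psh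
  F*₀ Γ@record { restr-id = rid ; restr-∘ = rc } = record
    { obj = λ V → PW.obj Γ (F₀ V)
    ; restr = λ γ φ → PW.restr Γ γ (F₁ φ)
    ; restr-id = λ γ → trans (cong (PW.restr Γ γ) F-id) (rid γ)
    ; restr-∘ = λ γ φ ψ → trans (cong (PW.restr Γ γ) (F-∘ φ ψ)) (rc γ (F₁ φ) (F₁ ψ))
    }

  F*₁ : ∀ {Δ Γ} → PW.NatTr Δ Γ → PV.NatTr (F*₀ Δ) (F*₀ Γ)
  F*₁ σ@record { nat = nσ } = record { fun = PW.fun σ ; nat = λ δ φ → nσ δ (F₁ φ) }

module Submission where

-- The idea is that F* changes nothing but the indexing: the elements of
-- F*Γ at V are the elements of Γ at F V, and restriction along φ is
-- restriction along F φ.  Applying the same recipe to types (presheaves on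
-- the category of elements) and terms gives the actions of F* on types and
-- terms.  Because substitution, the empty context and context comprehension
-- of the presheaf CwF are all defined pointwise on elements, every equation
-- required of a strict morphism (naturality, F◇ = ◇, F(Γ.T) = FΓ.FT,
-- Fπ = π, Fξ = ξ) then holds definitionally.  The only genuine proof
-- obligations are the functoriality laws of the reindexed types, which
-- follow from the laws of T together with F-id and F-∘, once we know that
-- type restriction only depends on the restricting morphism up to equality
-- (lemma trestr-cong).

open import Defs
open import Relation.Binary.PropositionalEquality using (_≡_; refl; trans; cong)
open import Relation.Binary.HeterogeneousEquality using (refl)
open import Data.Product using (_,_)

module _ {𝒲 : Category} where
  open Category 𝒲
  open Presheaves 𝒲

  trestr-cong : ∀ {Γ : Psh} (T : PTy Γ) {W V} {γ : obj Γ W} {γ' : obj Γ V}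
                {φ φ' : Hom V W} → φ ≡ φ' →
                .(e : restr Γ γ φ ≡ γ') .(e' : restr Γ γ φ' ≡ γ') (a : tobj T γ) →
                trestr T φ e a ≡ trestr T φ' e' a
  trestr-cong T refl e e' a = refl

module Precomposition {𝒱 𝒲 : Category} (F : Functor 𝒱 𝒲) where
  private
    module PV = Presheaves 𝒱
    module PW = Presheaves 𝒲
  open Functor F

  F*Ty : ∀ {Γ} → PW.PTy Γ → PV.PTy (F*₀ F Γ)
  F*Ty {Γ@record { restr-id = rid ; restr-∘ = rc }} T@record { trestr-id = tid ; trestr-∘ = tc } = record
    { tobj      = PW.tobj T
    ; trestr    = λ φ e a → PW.trestr T (F₁ φ) e a
    ; trestr-id = λ {_} {γ} e a → trans (trestr-cong T F-id e (rid γ) a) (tid (rid γ) a)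
    ; trestr-∘  = λ {_} {_} {_} {γ} φ ψ e₁ e₂ e a →
        -- T's composition law, instantiated at F₁ φ and F₁ ψ, after
        -- rewriting F₁ (φ ∘ ψ) to F₁ φ ∘ F₁ ψ
        trans (trestr-cong T (F-∘ φ ψ) e
                 (trans (rc γ (F₁ φ) (F₁ ψ)) (trans (cong (λ x → PW.restr Γ x (F₁ ψ)) e₁) e₂)) a)
              (tc (F₁ φ) (F₁ ψ) e₁ e₂ _ a)
    }

  F*Tm : ∀ {Γ} {T : PW.PTy Γ} → PW.PTm Γ T → PV.PTm (F*₀ F Γ) (F*Ty T)
  F*Tm a@record { tnat = ta } = record { tm = PW.tm a ; tnat = λ γ φ → ta γ (F₁ φ) }

  F*◇-terminal : IsTerminal (PshCwF 𝒱) (F*₀ F (PW.◇P))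
  F*◇-terminal Y = record { fun = λ _ → _ ; nat = λ _ _ → refl } , λ _ → refl

open Precomposition

-- With types and terms reindexed along F, every remaining equation of a
-- strict CwF morphism holds by definition; in particular the comparison map
-- F(Γ.T) → FΓ.FT is the identity.
mainTheorem1 : {𝒱 𝒲 : Category} (F : Functor 𝒱 𝒲) →
    IsStrictCwFMorphism (PshCwF 𝒲) (PshCwF 𝒱) (F*₀ F) (F*₁ F)
mainTheorem1 {𝒱} F = record
  { isMorphism = record
    { F-id        = refl
    ; F-∘         = λ _ _ → refl
    ; FTy         = F*Ty F
    ; FTy-nat     = λ _ _ → refl
    ; FTm         = F*Tm F
    ; FTm-nat     = λ _ _ → refl
    ; F◇-terminal = F*◇-terminal F
    ; F▷-iso      = λ _ → Presheaves.idN 𝒱 , refl , refl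
    }
  ; F◇ = refl
  ; F▷ = λ _ → refl
  ; Fp = λ _ → refl
  ; Fq = λ _ → refl
  }
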